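{- The real-order preserving approximate order on $K:=\{\bar1,0,1\}^{\mathbb{N}}$ relates to the real-order preserving preorder, i.e. for all $\alpha,\beta\in K$: (i) if $\alpha\le_K\beta$ then there exists (truncated) $n\in\mathbb{N}$ such that $\alpha\le^\varepsilon_K\beta$ for all $\varepsilon>n$; and (ii) if $\alpha\le^n_K\beta$ for all $n\in\mathbb{N}$, then $\alpha\le_K\beta$.
   Context: Constructive univalent type theory with propositional truncations; "there exists" denotes the truncated existential. Let $\mathrm{down}(\bar1)(k)=2k$, $\mathrm{down}(0)(k)=2k+1$, $\mathrm{down}(1)(k)=2k+2$ for $k\in\mathbb{Z}$. Define $a:\mathbb{Z}\to K\to\mathbb{N}\to\mathbb{Z}$ by $a(k,\alpha,0)=k$, $a(k,\alpha,n+1)=a(\mathrm{down}(\alpha_0)(k),\mathrm{tail}\,\alpha,n)$, and $\mathrm{integerApprox}(\alpha)_n:=a(-1,\alpha,n)$. The approximate order: $\alpha\le^n_K\beta$ iff $\mathrm{integerApprox}(\alpha)_n\le\mathrm{integerApprox}(\beta)_n$. The preorder: $\alpha\le_K\beta$ iff there exists (truncated) $n\in\mathbb{N}$ such that for all $i\ge n$, $\mathrm{integerApprox}(\alpha)_i\le\mathrm{integerApprox}(\beta)_i$. -}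

module Defs where

open import Data.Nat using (ℕ; zero; suc; _≥_; _>_)
open import Data.Integer using (ℤ; _+_; _*_; _≤_; -[1+_]; +_)
open import Data.Product using (Σ)
open import Relation.Binary.PropositionalEquality using (_≡_)

data 𝟛 : Set where
  −1 O +1 : 𝟛

K : Set
K = ℕ → 𝟛

tail : K → K
tail α n = α (suc n)

down : 𝟛 → ℤ → ℤ
down −1 k = (+ 2) * k
down O  k = (+ 2) * k + + 1
down +1 k = (+ 2) * k + + 2

a : ℤ → K → ℕ → ℤ
a k α zero    = k
a k α (suc n) = a (down (α 0) k) (tail α) n

integerApprox : K → ℕ → ℤ
integerApprox α n = a -[1+ 0 ] α n

_≤[_]K_ : K → ℕ → K → Set
α ≤[ n ]K β = integerApprox α n ≤ integerApprox β n

-- mere propositions and the (impredicatively encoded) propositional truncation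
isProp : Set → Set
isProp P = (x y : P) → x ≡ y

∥_∥ : Set → Set₁
∥ A ∥ = {P : Set} → isProp P → (A → P) → P

∃∥ : (ℕ → Set) → Set₁
∃∥ B = ∥ Σ ℕ B ∥

_≤K_ : K → K → Set₁
α ≤K β = ∃∥ (λ n → (i : ℕ) → i ≥ n → integerApprox α i ≤ integerApprox β i)

module Submission where

open import Defs
open import Data.Nat using (ℕ; _>_)
open import Data.Nat.Properties using (<⇒≤)
open import Data.Product using (Σ; _×_; _,_)

∥∥-map : {A B : Set} → (A → B) → ∥ A ∥ → ∥ B ∥
∥∥-map f ∣a∣ isPropP g = ∣a∣ isPropP (λ x → g (f x))

∣_∣ : {A : Set} → A → ∥ A ∥
∣ x ∣ _ g = g x

≤K⇒eventually-≤[]K : (α β : K)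
  → α ≤K β → ∃∥ (λ n → (ε : ℕ) → ε > n → α ≤[ ε ]K β)
≤K⇒eventually-≤[]K α β =
  ∥∥-map (λ { (n , from-n) → n , λ ε ε>n → from-n ε (<⇒≤ ε>n) })

≤[]K-everywhere⇒≤K : (α β : K) → ((n : ℕ) → α ≤[ n ]K β) → α ≤K β
≤[]K-everywhere⇒≤K α β everywhere = ∣ 0 , (λ i _ → everywhere i) ∣

lemma6p11 : (α β : K)
    → (α ≤K β → ∃∥ (λ n → (ε : ℕ) → ε > n → α ≤[ ε ]K β))
    × (((n : ℕ) → α ≤[ n ]K β) → α ≤K β)
lemma6p11 α β = ≤K⇒eventually-≤[]K α β , ≤[]K-everywhere⇒≤K α β
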